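{- Let $d\ge0$ and $a\ge1$ be integers and let $G$ be a $d$-regular graph on $n=a(d+1)$ vertices. Then \[ i(G)\ge i(aK_{d+1})=(d+2)^a. \] Indeed, for all $0\le t\le n$ we have $i_t(G)\ge i_t(aK_{d+1})=(d+1)^t\binom{a}{t}$.
   Context: Graphs are finite and simple. $i(G)$ is the number of independent sets of $G$ (including the empty set), and $i_t(G)$ is the number of independent sets of $G$ of size exactly $t$. $aK_{d+1}$ is the disjoint union of $a$ copies of the complete graph $K_{d+1}$; $\binom{a}{t}=0$ for $t>a$. -}

module Defs where

open import Data.Nat using (ℕ; zero; suc; _+_; _*_; _≤_)
open import Data.Nat.DivMod using (_/_)
open import Data.Bool using (Bool; true; false; _∧_; not; if_then_else_)
open import Data.Fin using (Fin; toℕ)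
open import Data.Vec using (Vec; []; _∷_; lookup)
open import Data.List using (List; []; _∷_; map; _++_; length; filter)
open import Data.List using (allFin)
open import Relation.Binary.PropositionalEquality using (_≡_)
open import Relation.Nullary.Decidable using (⌊_⌋)
open import Data.Nat using (_≡ᵇ_)
open import Data.Fin using (_≟_)

record Graph (n : ℕ) : Set where
  field
    adj   : Fin n → Fin n → Bool
    sym   : ∀ u v → adj u v ≡ adj v u
    irrefl : ∀ v → adj v v ≡ false
open Graph public

count : {A : Set} → (A → Bool) → List A → ℕ
count p xs = length (filter (λ x → p x Data.Bool.≟ true) xs)

degree : ∀ {n} → Graph n → Fin n → ℕ
degree G v = count (adj G v) (allFin _)

Regular : ∀ {n} → ℕ → Graph n → Set
Regular d G = ∀ v → degree G v ≡ d

allSubsets : (n : ℕ) → List (Vec Bool n)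
allSubsets zero = [] ∷ []
allSubsets (suc n) = map (true ∷_) (allSubsets n) ++ map (false ∷_) (allSubsets n)

size : ∀ {n} → Vec Bool n → ℕ
size [] = 0
size (true ∷ s) = suc (size s)
size (false ∷ s) = size s

allL : {A : Set} → (A → Bool) → List A → Bool
allL p [] = true
allL p (x ∷ xs) = p x ∧ allL p xs

isIndependent : ∀ {n} → Graph n → Vec Bool n → Bool
isIndependent {n} G S =
  allL (λ u → allL (λ v → not (lookup S u ∧ lookup S v ∧ adj G u v)) (allFin n)) (allFin n)

-- i(G): number of independent sets (including the empty set)
indepCount : ∀ {n} → Graph n → ℕ
indepCount {n} G = count (isIndependent G) (allSubsets n)

indepCountOfSize : ∀ {n} → Graph n → ℕ → ℕ
indepCountOfSize {n} G t =
  count (λ S → isIndependent G S ∧ (size S ≡ᵇ t)) (allSubsets n)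

-- a K_{d+1}: vertex i of Fin (a * (d+1)) lies in block ⌊i/(d+1)⌋;
-- two distinct vertices are adjacent iff they lie in the same block.
cliques : (a d : ℕ) → Graph (a * suc d)
cliques a d = record
  { adj = λ u v → not ⌊ u ≟ v ⌋ ∧ ((toℕ u / suc d) ≡ᵇ (toℕ v / suc d))
  ; sym = symP
  ; irrefl = irr }
  where
  open import Relation.Nullary using (yes; no)
  open import Relation.Binary.PropositionalEquality using (refl; sym; cong)
  open import Data.Nat.Properties using (≡ᵇ⇒≡; ≡⇒≡ᵇ)
  symP : ∀ u v → (not ⌊ u ≟ v ⌋ ∧ ((toℕ u / suc d) ≡ᵇ (toℕ v / suc d)))
               ≡ (not ⌊ v ≟ u ⌋ ∧ ((toℕ v / suc d) ≡ᵇ (toℕ u / suc d)))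
  symP u v with u ≟ v | v ≟ u
  ... | yes _ | yes _ = refl
  ... | no _ | no _ = bEq (toℕ u / suc d) (toℕ v / suc d)
    where
    bEq : ∀ x y → (x ≡ᵇ y) ≡ (y ≡ᵇ x)
    bEq zero zero = refl
    bEq zero (suc y) = refl
    bEq (suc x) zero = refl
    bEq (suc x) (suc y) = bEq x y
  ... | yes refl | no p = Data.Empty.⊥-elim (p refl)
    where import Data.Empty
  ... | no p | yes refl = Data.Empty.⊥-elim (p refl)
    where import Data.Empty
  irr : ∀ v → (not ⌊ v ≟ v ⌋ ∧ ((toℕ v / suc d) ≡ᵇ (toℕ v / suc d))) ≡ false
  irr v with v ≟ v
  ... | yes _ = refl
  ... | no p = Data.Empty.⊥-elim (p refl)
    where import Data.Empty

-- Let N[v] be the closed neighbourhood of v, so |N[v]| = d + 1. A vertex v can be added to an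
-- independent t-set S exactly when N[v] ∩ S = ∅, so counting the pairs (S, v) gives
-- (t + 1) i_{t+1}(G) = Σ_S #{v : N[v] ∩ S = ∅}. The sets N[v] ∩ S have total size t (d + 1), so at
-- least n − t (d + 1) of them are empty, with equality in aK_{d+1} where each has at most one element.
-- Thus (t + 1) i_{t+1} ≥ (n − t (d + 1)) i_t in G with equality in aK_{d+1}; as (d + 1)^t C(a, t)
-- satisfies the equality and i_0 = 1, induction on t gives the claim for i_t, and summing over t
-- (binomial theorem) the claim for i.

module Submission where

open import Data.Bool using (Bool; true; false; _∧_; _∨_; not)
open import Data.Bool.Properties using (∧-conicalˡ; ∧-conicalʳ; ∧-zeroʳ; not-injective; T-≡; ⇔→≡)
open import Data.Fin using (Fin; zero; suc; toℕ; _≟_)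
import Data.Fin.Properties as Fin
open import Data.Fin.Properties using (toℕ<n)
open import Data.List using (List; []; _∷_; map; _++_; tabulate)
open import Data.Nat
  using (ℕ; zero; suc; _+_; _*_; _∸_; _^_; _≤_; _<_; _≥_; z≤n; s≤s; _≡ᵇ_)
open import Data.Nat.Properties hiding (_≟_)
open import Data.Nat.Combinatorics using (_C_; nC1≡n; nCk+nC[k+1]≡[n+1]C[k+1]; k>n⇒nCk≡0)
open import Data.Nat.Solver using (module +-*-Solver)
open import Data.Nat.DivMod using (_/_; m<n⇒m/n≡0; m/n≡1+[m∸n]/n; m<n*o⇒m/o<n)
open import Data.Product using (_×_; _,_)
open import Data.Vec using (Vec; []; _∷_; lookup; _[_]≔_)
open import Data.Vec.Properties using (lookup∘update; lookup∘update′)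
open import Function using (_∘_; id; mk⇔; Equivalence)
open import Relation.Binary.PropositionalEquality
open import Relation.Nullary using (yes; no; contradiction)
open import Relation.Nullary.Decidable using (⌊_⌋)

open import Algebra.Properties.Semiring.Sum +-*-semiring
  using (sum; sum-syntax; ∑-comm; ∑-distrib-+; *-distribˡ-sum; *-distribʳ-sum; sum-cong-≗)

open import Defs renaming (sym to adj-sym)

⟦_⟧ : Bool → ℕ
⟦ true ⟧ = 1
⟦ false ⟧ = 0

⟦∧⟧ : ∀ x y → ⟦ x ∧ y ⟧ ≡ ⟦ x ⟧ * ⟦ y ⟧
⟦∧⟧ true y = sym (+-identityʳ ⟦ y ⟧)
⟦∧⟧ false y = refl

⟦∧∧⟧ : ∀ x y z → ⟦ (x ∧ y) ∧ z ⟧ ≡ ⟦ x ∧ z ⟧ * ⟦ y ⟧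
⟦∧∧⟧ false y z = refl
⟦∧∧⟧ true true z = sym (*-identityʳ ⟦ z ⟧)
⟦∧∧⟧ true false z = sym (*-zeroʳ ⟦ z ⟧)

⟦⟧*-cong : ∀ b {x y} → (b ≡ true → x ≡ y) → ⟦ b ⟧ * x ≡ ⟦ b ⟧ * y
⟦⟧*-cong true x≡y = cong (1 *_) (x≡y refl)
⟦⟧*-cong false x≡y = refl

⟦⟧*-mono-≤ : ∀ b {x y} → (b ≡ true → x ≤ y) → ⟦ b ⟧ * x ≤ ⟦ b ⟧ * y
⟦⟧*-mono-≤ true x≤y = *-monoʳ-≤ 1 (x≤y refl)
⟦⟧*-mono-≤ false x≤y = z≤n

⟦⟧≡0⇒≡false : ∀ {x} → ⟦ x ⟧ ≡ 0 → x ≡ false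
⟦⟧≡0⇒≡false {false} _ = refl

≡ᵇ-true⇒≡ : ∀ {m n} → (m ≡ᵇ n) ≡ true → m ≡ n
≡ᵇ-true⇒≡ {m} {n} eq = ≡ᵇ⇒≡ m n (Equivalence.from T-≡ eq)

≡ᵇ-refl : ∀ m → (m ≡ᵇ m) ≡ true
≡ᵇ-refl m = Equivalence.to T-≡ (≡⇒≡ᵇ m m refl)

≡ᵇ0-indicator+≥1 : ∀ m → 1 ≤ ⟦ m ≡ᵇ 0 ⟧ + m
≡ᵇ0-indicator+≥1 zero = ≤-refl
≡ᵇ0-indicator+≥1 (suc m) = s≤s z≤n

≡ᵇ0-indicator+≡1 : ∀ {m} → m ≤ 1 → ⟦ m ≡ᵇ 0 ⟧ + m ≡ 1
≡ᵇ0-indicator+≡1 z≤n = refl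
≡ᵇ0-indicator+≡1 (s≤s z≤n) = refl

∑-mono-≤ : ∀ {n} {f g : Fin n → ℕ} → (∀ i → f i ≤ g i) → sum f ≤ sum g
∑-mono-≤ {zero} f≤g = z≤n
∑-mono-≤ {suc n} f≤g = +-mono-≤ (f≤g zero) (∑-mono-≤ (f≤g ∘ suc))

∑-zero : ∀ n → ∑[ i < n ] 0 ≡ 0
∑-zero zero = refl
∑-zero (suc n) = ∑-zero n

∑-one : ∀ n → ∑[ i < n ] 1 ≡ n
∑-one zero = refl
∑-one (suc n) = cong suc (∑-one n)

∑≡0⇒≡0 : ∀ {n} (f : Fin n → ℕ) → sum f ≡ 0 → ∀ i → f i ≡ 0
∑≡0⇒≡0 f ∑f≡0 zero = m+n≡0⇒m≡0 (f zero) ∑f≡0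
∑≡0⇒≡0 f ∑f≡0 (suc i) = ∑≡0⇒≡0 (f ∘ suc) (m+n≡0⇒n≡0 (f zero) ∑f≡0) i

∑-δ : ∀ {n} (u : Fin n) → ∑[ v < n ] ⟦ ⌊ u ≟ v ⌋ ⟧ ≡ 1
∑-δ {suc n} zero = cong suc (∑-zero n)
∑-δ {suc n} (suc u) = trans (sum-cong-≗ δ-suc) (∑-δ u)
  where
  δ-suc : ∀ v → ⟦ ⌊ suc u ≟ suc v ⌋ ⟧ ≡ ⟦ ⌊ u ≟ v ⌋ ⟧
  δ-suc v with u ≟ v
  ... | yes _ = refl
  ... | no _ = refl

∑-δℕ : ∀ m s → s < m → ∑[ t < m ] ⟦ s ≡ᵇ toℕ t ⟧ ≡ 1
∑-δℕ (suc m) zero _ = cong suc (∑-zero m)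
∑-δℕ (suc m) (suc s) (s≤s s<m) = ∑-δℕ m s s<m

∑-⟦⟧-≤1 : ∀ {n} (f : Fin n → Bool) → (∀ i j → f i ≡ true → f j ≡ true → i ≡ j) →
          ∑[ i < n ] ⟦ f i ⟧ ≤ 1
∑-⟦⟧-≤1 {zero} f unique = z≤n
∑-⟦⟧-≤1 {suc n} f unique with f zero in f0
... | true = ≤-reflexive (cong suc (trans (sum-cong-≗ rest-false) (∑-zero n)))
  where
  rest-false : ∀ j → ⟦ f (suc j) ⟧ ≡ 0
  rest-false j with f (suc j) in fj
  ... | false = refl
  ... | true with () ← unique zero (suc j) f0 fj
... | false = ∑-⟦⟧-≤1 (f ∘ suc) (λ i j fi fj → Fin.suc-injective (unique (suc i) (suc j) fi fj))

∑-+-split : ∀ m p (g : ℕ → ℕ) → ∑[ i < m + p ] g (toℕ i) ≡ ∑[ i < m ] g (toℕ i) + ∑[ i < p ] g (m + toℕ i)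
∑-+-split zero p g = refl
∑-+-split (suc m) p g = trans (cong (g 0 +_) (∑-+-split m p (g ∘ suc))) (sym (+-assoc (g 0) _ _))

count-∷ : {A : Set} (p : A → Bool) (x : A) (xs : List A) →
          count p (x ∷ xs) ≡ ⟦ p x ⟧ + count p xs
count-∷ p x xs with p x
... | true = refl
... | false = refl

count-tabulate : ∀ {n} {A : Set} (p : A → Bool) (f : Fin n → A) →
                 count p (tabulate f) ≡ ∑[ i < n ] ⟦ p (f i) ⟧
count-tabulate {zero} p f = refl
count-tabulate {suc n} p f =
  trans (count-∷ p (f zero) _) (cong (⟦ p (f zero) ⟧ +_) (count-tabulate p (f ∘ suc)))

count-++ : {A : Set} (p : A → Bool) (xs ys : List A) →
           count p (xs ++ ys) ≡ count p xs + count p ys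
count-++ p [] ys = refl
count-++ p (x ∷ xs) ys = begin
  count p (x ∷ xs ++ ys)                  ≡⟨ count-∷ p x (xs ++ ys) ⟩
  ⟦ p x ⟧ + count p (xs ++ ys)            ≡⟨ cong (⟦ p x ⟧ +_) (count-++ p xs ys) ⟩
  ⟦ p x ⟧ + (count p xs + count p ys)     ≡⟨ +-assoc ⟦ p x ⟧ _ _ ⟨
  ⟦ p x ⟧ + count p xs + count p ys       ≡⟨ cong (_+ count p ys) (count-∷ p x xs) ⟨
  count p (x ∷ xs) + count p ys           ∎
  where open ≡-Reasoning

count-map : {A B : Set} (p : B → Bool) (f : A → B) (xs : List A) →
            count p (map f xs) ≡ count (p ∘ f) xs
count-map p f [] = refl
count-map p f (x ∷ xs) =
  trans (count-∷ p (f x) (map f xs))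
        (trans (cong (⟦ p (f x) ⟧ +_) (count-map p f xs)) (sym (count-∷ (p ∘ f) x xs)))

Σₛ : ∀ {n} → (Vec Bool n → ℕ) → ℕ
Σₛ {zero} f = f []
Σₛ {suc n} f = Σₛ (f ∘ (true ∷_)) + Σₛ (f ∘ (false ∷_))

Σₛ-cong : ∀ {n} {f g : Vec Bool n → ℕ} → (∀ S → f S ≡ g S) → Σₛ f ≡ Σₛ g
Σₛ-cong {zero} f≗g = f≗g []
Σₛ-cong {suc n} f≗g = cong₂ _+_ (Σₛ-cong (f≗g ∘ (true ∷_))) (Σₛ-cong (f≗g ∘ (false ∷_)))

Σₛ-zero : ∀ n → Σₛ {n} (λ _ → 0) ≡ 0
Σₛ-zero zero = refl
Σₛ-zero (suc n) = cong₂ _+_ (Σₛ-zero n) (Σₛ-zero n)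

Σₛ-mono-≤ : ∀ {n} {f g : Vec Bool n → ℕ} → (∀ S → f S ≤ g S) → Σₛ f ≤ Σₛ g
Σₛ-mono-≤ {zero} f≤g = f≤g []
Σₛ-mono-≤ {suc n} f≤g = +-mono-≤ (Σₛ-mono-≤ (f≤g ∘ (true ∷_))) (Σₛ-mono-≤ (f≤g ∘ (false ∷_)))

Σₛ-*ʳ : ∀ {n} (k : ℕ) (f : Vec Bool n → ℕ) → Σₛ (λ S → f S * k) ≡ Σₛ f * k
Σₛ-*ʳ {zero} k f = refl
Σₛ-*ʳ {suc n} k f =
  trans (cong₂ _+_ (Σₛ-*ʳ k (f ∘ (true ∷_))) (Σₛ-*ʳ k (f ∘ (false ∷_))))
        (sym (*-distribʳ-+ k (Σₛ (f ∘ (true ∷_))) (Σₛ (f ∘ (false ∷_)))))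

Σₛ-∑-comm : ∀ {n m} (f : Vec Bool n → Fin m → ℕ) →
            Σₛ (λ S → ∑[ j < m ] f S j) ≡ ∑[ j < m ] Σₛ (λ S → f S j)
Σₛ-∑-comm {zero} f = refl
Σₛ-∑-comm {suc n} f =
  trans (cong₂ _+_ (Σₛ-∑-comm (f ∘ (true ∷_))) (Σₛ-∑-comm (f ∘ (false ∷_))))
        (sym (∑-distrib-+ (λ j → Σₛ (λ S → f (true ∷ S) j)) (λ j → Σₛ (λ S → f (false ∷ S) j))))

count-allSubsets : ∀ n (p : Vec Bool n → Bool) → count p (allSubsets n) ≡ Σₛ (⟦_⟧ ∘ p)
count-allSubsets zero p = trans (count-∷ p [] []) (+-identityʳ ⟦ p [] ⟧)
count-allSubsets (suc n) p = begin
  count p (map (true ∷_) (allSubsets n) ++ map (false ∷_) (allSubsets n))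
    ≡⟨ count-++ p (map (true ∷_) (allSubsets n)) (map (false ∷_) (allSubsets n)) ⟩
  count p (map (true ∷_) (allSubsets n)) + count p (map (false ∷_) (allSubsets n))
    ≡⟨ cong₂ _+_ (count-map p (true ∷_) (allSubsets n)) (count-map p (false ∷_) (allSubsets n)) ⟩
  count (p ∘ (true ∷_)) (allSubsets n) + count (p ∘ (false ∷_)) (allSubsets n)
    ≡⟨ cong₂ _+_ (count-allSubsets n (p ∘ (true ∷_))) (count-allSubsets n (p ∘ (false ∷_))) ⟩
  Σₛ (⟦_⟧ ∘ p) ∎
  where open ≡-Reasoning

-- Both sides sum g over the sets containing v: on the right each appears as S ∪ {v} with v ∉ S.
Σₛ-insert : ∀ {n} (v : Fin n) (g : Vec Bool n → ℕ) →
            Σₛ (λ S → ⟦ lookup S v ⟧ * g S) ≡ Σₛ (λ S → ⟦ not (lookup S v) ⟧ * g (S [ v ]≔ true))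
Σₛ-insert {suc n} zero g = +-comm (Σₛ (λ S → 1 * g (true ∷ S))) (Σₛ {n} (λ _ → 0))
Σₛ-insert (suc v) g = cong₂ _+_ (Σₛ-insert v (g ∘ (true ∷_))) (Σₛ-insert v (g ∘ (false ∷_)))

size-∑ : ∀ {n} (S : Vec Bool n) → size S ≡ ∑[ v < n ] ⟦ lookup S v ⟧
size-∑ [] = refl
size-∑ (true ∷ S) = cong suc (size-∑ S)
size-∑ (false ∷ S) = size-∑ S

size-≤ : ∀ {n} (S : Vec Bool n) → size S ≤ n
size-≤ [] = z≤n
size-≤ (true ∷ S) = s≤s (size-≤ S)
size-≤ (false ∷ S) = m≤n⇒m≤1+n (size-≤ S)

size-insert : ∀ {n} (S : Vec Bool n) v → lookup S v ≡ false → size (S [ v ]≔ true) ≡ suc (size S)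
size-insert (false ∷ S) zero _ = refl
size-insert (true ∷ S) (suc v) v∉S = cong suc (size-insert S v v∉S)
size-insert (false ∷ S) (suc v) v∉S = size-insert S v v∉S

Σₛ-size≡0 : ∀ n → Σₛ {n} (λ S → ⟦ size S ≡ᵇ 0 ⟧) ≡ 1
Σₛ-size≡0 zero = refl
Σₛ-size≡0 (suc n) = cong₂ _+_ (Σₛ-zero n) (Σₛ-size≡0 n)

allL-tabulate⁻ : ∀ {n} {A : Set} (p : A → Bool) (f : Fin n → A) →
                 allL p (tabulate f) ≡ true → ∀ i → p (f i) ≡ true
allL-tabulate⁻ {suc n} p f all-p i with p (f zero) in p₀ | i
... | true | zero = p₀
... | true | suc j = allL-tabulate⁻ p (f ∘ suc) all-p j

allL-tabulate⁺ : ∀ {n} {A : Set} (p : A → Bool) (f : Fin n → A) →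
                 (∀ i → p (f i) ≡ true) → allL p (tabulate f) ≡ true
allL-tabulate⁺ {zero} p f all-p = refl
allL-tabulate⁺ {suc n} p f all-p rewrite all-p zero = allL-tabulate⁺ p (f ∘ suc) (all-p ∘ suc)

-- Independent sets and closed neighbourhoods

module _ {n} (G : Graph n) where

  closedAdj : Fin n → Fin n → Bool
  closedAdj u v = ⌊ u ≟ v ⌋ ∨ adj G u v

  closedAdj-refl : ∀ v → closedAdj v v ≡ true
  closedAdj-refl v with v ≟ v
  ... | yes _ = refl
  ... | no v≢v = contradiction refl v≢v

  Independent : Vec Bool n → Set
  Independent S = ∀ u w → lookup S u ≡ true → lookup S w ≡ true → adj G u w ≡ false

  isIndependent⁻ : ∀ S → isIndependent G S ≡ true → Independent S
  isIndependent⁻ S ind u w u∈S w∈S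
    with allL-tabulate⁻ _ id (allL-tabulate⁻ _ id ind u) w
  ... | no-edge rewrite u∈S | w∈S = not-injective no-edge

  isIndependent⁺ : ∀ S → Independent S → isIndependent G S ≡ true
  isIndependent⁺ S ind = allL-tabulate⁺ _ id λ u → allL-tabulate⁺ _ id λ w → no-edge u w
    where
    no-edge : ∀ u w → not (lookup S u ∧ lookup S w ∧ adj G u w) ≡ true
    no-edge u w with lookup S u in u∈S | lookup S w in w∈S
    ... | false | _ = refl
    ... | true | false = refl
    ... | true | true rewrite ind u w u∈S w∈S = refl

  coverCount : Vec Bool n → Fin n → ℕ
  coverCount S v = ∑[ u < n ] ⟦ lookup S u ∧ closedAdj u v ⟧

  Uncovered : Vec Bool n → Fin n → Set
  Uncovered S v = ∀ u → lookup S u ≡ true → closedAdj u v ≡ false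

  coverCount≡0⇒ : ∀ S v → coverCount S v ≡ 0 → Uncovered S v
  coverCount≡0⇒ S v cover≡0 u u∈S with ⟦⟧≡0⇒≡false (∑≡0⇒≡0 _ cover≡0 u)
  ... | not-both rewrite u∈S = not-both

  coverCount≡0⇐ : ∀ S v → Uncovered S v → coverCount S v ≡ 0
  coverCount≡0⇐ S v uncovered = trans (sum-cong-≗ term≡0) (∑-zero n)
    where
    term≡0 : ∀ u → ⟦ lookup S u ∧ closedAdj u v ⟧ ≡ 0
    term≡0 u with lookup S u in u∈S
    ... | false = refl
    ... | true rewrite uncovered u u∈S = refl

  addable : Vec Bool n → ℕ
  addable S = ∑[ v < n ] ⟦ coverCount S v ≡ᵇ 0 ⟧

  isIndependent-insert : ∀ S v → lookup S v ≡ false →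
    isIndependent G (S [ v ]≔ true) ≡ isIndependent G S ∧ (coverCount S v ≡ᵇ 0)
  isIndependent-insert S v v∉S = ⇔→≡ (mk⇔ extend⁻ extend⁺)
    where
    S′ : Vec Bool n
    S′ = S [ v ]≔ true

    ⊆S′ : ∀ u → lookup S u ≡ true → lookup S′ u ≡ true
    ⊆S′ u u∈S with u ≟ v
    ... | yes refl = lookup∘update u S true
    ... | no u≢v = trans (lookup∘update′ u≢v S true) u∈S

    S′⊆ : ∀ u → u ≢ v → lookup S′ u ≡ true → lookup S u ≡ true
    S′⊆ u u≢v u∈S′ = trans (sym (lookup∘update′ u≢v S true)) u∈S′

    extend⁻ : isIndependent G S′ ≡ true → isIndependent G S ∧ (coverCount S v ≡ᵇ 0) ≡ true
    extend⁻ ind′ = cong₂ _∧_ (isIndependent⁺ S (λ u w u∈S w∈S → I′ u w (⊆S′ u u∈S) (⊆S′ w w∈S)))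
                             (cong (_≡ᵇ 0) (coverCount≡0⇐ S v uncovered))
      where
      I′ : Independent S′
      I′ = isIndependent⁻ S′ ind′
      uncovered : Uncovered S v
      uncovered u u∈S with u ≟ v
      ... | yes refl with () ← trans (sym u∈S) v∉S
      ... | no _ = I′ u v (⊆S′ u u∈S) (lookup∘update v S true)

    extend⁺ : isIndependent G S ∧ (coverCount S v ≡ᵇ 0) ≡ true → isIndependent G S′ ≡ true
    extend⁺ hyp = isIndependent⁺ S′ I′
      where
      I : Independent S
      I = isIndependent⁻ S (∧-conicalˡ _ _ hyp)
      uncovered : Uncovered S v
      uncovered = coverCount≡0⇒ S v (≡ᵇ-true⇒≡ (∧-conicalʳ _ _ hyp))
      edge-free : ∀ u → lookup S u ≡ true → adj G u v ≡ false
      edge-free u u∈S with u ≟ v | uncovered u u∈S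
      ... | no _ | no-edge = no-edge
      I′ : Independent S′
      I′ u w u∈S′ w∈S′ with u ≟ v | w ≟ v
      ... | yes refl | yes refl = irrefl G u
      ... | yes refl | no w≢v = trans (adj-sym G u w) (edge-free w (S′⊆ w w≢v w∈S′))
      ... | no u≢v | yes refl = edge-free u (S′⊆ u u≢v u∈S′)
      ... | no u≢v | no w≢v = I u w (S′⊆ u u≢v u∈S′) (S′⊆ w w≢v w∈S′)

  isIndependentOfSize : ℕ → Vec Bool n → Bool
  isIndependentOfSize t S = isIndependent G S ∧ (size S ≡ᵇ t)

  isIndependentOfSize⇒isIndependent : ∀ {t} S → isIndependentOfSize t S ≡ true → isIndependent G S ≡ true
  isIndependentOfSize⇒isIndependent {t} S = ∧-conicalˡ (isIndependent G S) (size S ≡ᵇ t)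

  isIndependentOfSize⇒size≡ : ∀ {t} S → isIndependentOfSize t S ≡ true → size S ≡ t
  isIndependentOfSize⇒size≡ {t} S = ≡ᵇ-true⇒≡ ∘ ∧-conicalʳ (isIndependent G S) (size S ≡ᵇ t)

  indepCountOfSize-Σₛ : ∀ t → indepCountOfSize G t ≡ Σₛ (⟦_⟧ ∘ isIndependentOfSize t)
  indepCountOfSize-Σₛ t = count-allSubsets n (isIndependentOfSize t)

  indepCountOfSize-zero : indepCountOfSize G 0 ≡ 1
  indepCountOfSize-zero =
    trans (indepCountOfSize-Σₛ 0) (trans (Σₛ-cong empty-only) (Σₛ-size≡0 n))
    where
    empty-only : ∀ S → ⟦ isIndependentOfSize 0 S ⟧ ≡ ⟦ size S ≡ᵇ 0 ⟧
    empty-only S with size S in size≡0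
    ... | suc _ = cong ⟦_⟧ (∧-zeroʳ (isIndependent G S))
    ... | zero = cong (λ b → ⟦ b ∧ true ⟧)
                      (isIndependent⁺ S (λ u _ u∈S _ → contradiction (trans (sym u∈S) (empty u)) λ ()))
      where
      empty : ∀ u → lookup S u ≡ false
      empty u = ⟦⟧≡0⇒≡false (∑≡0⇒≡0 _ (trans (sym (size-∑ S)) size≡0) u)

  indepCount-∑ : indepCount G ≡ ∑[ t < suc n ] indepCountOfSize G (toℕ t)
  indepCount-∑ = begin
    indepCount G
      ≡⟨ count-allSubsets n (isIndependent G) ⟩
    Σₛ (λ S → ⟦ isIndependent G S ⟧)
      ≡⟨ Σₛ-cong split-by-size ⟩
    Σₛ (λ S → ∑[ t < suc n ] ⟦ isIndependentOfSize (toℕ t) S ⟧)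
      ≡⟨ Σₛ-∑-comm {n} {suc n} (λ S t → ⟦ isIndependentOfSize (toℕ t) S ⟧) ⟩
    ∑[ t < suc n ] Σₛ (⟦_⟧ ∘ isIndependentOfSize (toℕ t))
      ≡⟨ sum-cong-≗ {suc n} (sym ∘ indepCountOfSize-Σₛ ∘ toℕ) ⟩
    ∑[ t < suc n ] indepCountOfSize G (toℕ t) ∎
    where
    open ≡-Reasoning
    split-by-size : ∀ S → ⟦ isIndependent G S ⟧ ≡ ∑[ t < suc n ] ⟦ isIndependentOfSize (toℕ t) S ⟧
    split-by-size S = sym (begin
      ∑[ t < suc n ] ⟦ isIndependent G S ∧ (size S ≡ᵇ toℕ t) ⟧
        ≡⟨ sum-cong-≗ {suc n} (λ t → ⟦∧⟧ (isIndependent G S) (size S ≡ᵇ toℕ t)) ⟩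
      ∑[ t < suc n ] (⟦ isIndependent G S ⟧ * ⟦ size S ≡ᵇ toℕ t ⟧)
        ≡⟨ *-distribˡ-sum {suc n} ⟦ isIndependent G S ⟧ (λ t → ⟦ size S ≡ᵇ toℕ t ⟧) ⟨
      ⟦ isIndependent G S ⟧ * ∑[ t < suc n ] ⟦ size S ≡ᵇ toℕ t ⟧
        ≡⟨ cong (⟦ isIndependent G S ⟧ *_) (∑-δℕ (suc n) (size S) (s≤s (size-≤ S))) ⟩
      ⟦ isIndependent G S ⟧ * 1
        ≡⟨ *-identityʳ _ ⟩
      ⟦ isIndependent G S ⟧ ∎)

  size-indicator : ∀ t S → ⟦ isIndependentOfSize t S ⟧ * size S ≡ ⟦ isIndependentOfSize t S ⟧ * t
  size-indicator t S = ⟦⟧*-cong (isIndependentOfSize t S) (isIndependentOfSize⇒size≡ S)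

  insert-indicator : ∀ t S v →
    ⟦ not (lookup S v) ⟧ * ⟦ isIndependentOfSize (suc t) (S [ v ]≔ true) ⟧
      ≡ ⟦ isIndependentOfSize t S ⟧ * ⟦ coverCount S v ≡ᵇ 0 ⟧
  insert-indicator t S v with lookup S v in v∈S
  ... | false rewrite size-insert S v v∈S | isIndependent-insert S v v∈S =
    trans (+-identityʳ _) (⟦∧∧⟧ (isIndependent G S) (coverCount S v ≡ᵇ 0) (size S ≡ᵇ t))
  ... | true = sym (trans (cong (λ b → ⟦ isIndependentOfSize t S ⟧ * ⟦ b ⟧) covered) (*-zeroʳ ⟦ isIndependentOfSize t S ⟧))
    where
    covered : (coverCount S v ≡ᵇ 0) ≡ false
    covered with coverCount S v in cover≡0
    ... | suc _ = refl
    ... | zero = contradiction (trans (sym (closedAdj-refl v)) (coverCount≡0⇒ S v cover≡0 v v∈S)) λ ()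

  -- Count pairs (T, v) with T an independent (t+1)-set and v ∈ T, via T = S ∪ {v}.
  doubleCount : ∀ t →
    suc t * indepCountOfSize G (suc t) ≡ Σₛ (λ S → ⟦ isIndependentOfSize t S ⟧ * addable S)
  doubleCount t = begin
    suc t * indepCountOfSize G (suc t)
      ≡⟨ cong (suc t *_) (indepCountOfSize-Σₛ (suc t)) ⟩
    suc t * Σₛ I⁺
      ≡⟨ *-comm (suc t) (Σₛ I⁺) ⟩
    Σₛ I⁺ * suc t
      ≡⟨ Σₛ-*ʳ (suc t) I⁺ ⟨
    Σₛ (λ S → I⁺ S * suc t)
      ≡⟨ Σₛ-cong members ⟩
    Σₛ (λ S → ∑[ v < n ] (⟦ lookup S v ⟧ * I⁺ S))
      ≡⟨ Σₛ-∑-comm {n} {n} (λ S v → ⟦ lookup S v ⟧ * I⁺ S) ⟩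
    ∑[ v < n ] Σₛ (λ S → ⟦ lookup S v ⟧ * I⁺ S)
      ≡⟨ sum-cong-≗ {n} (λ v → Σₛ-insert v I⁺) ⟩
    ∑[ v < n ] Σₛ (λ S → ⟦ not (lookup S v) ⟧ * I⁺ (S [ v ]≔ true))
      ≡⟨ sum-cong-≗ {n} (λ v → Σₛ-cong (λ S → insert-indicator t S v)) ⟩
    ∑[ v < n ] Σₛ (λ S → I S * ⟦ coverCount S v ≡ᵇ 0 ⟧)
      ≡⟨ Σₛ-∑-comm {n} {n} (λ S v → I S * ⟦ coverCount S v ≡ᵇ 0 ⟧) ⟨
    Σₛ (λ S → ∑[ v < n ] (I S * ⟦ coverCount S v ≡ᵇ 0 ⟧))
      ≡⟨ Σₛ-cong (λ S → *-distribˡ-sum {n} (I S) (λ v → ⟦ coverCount S v ≡ᵇ 0 ⟧)) ⟨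
    Σₛ (λ S → I S * addable S) ∎
    where
    open ≡-Reasoning
    I I⁺ : Vec Bool n → ℕ
    I = ⟦_⟧ ∘ isIndependentOfSize t
    I⁺ = ⟦_⟧ ∘ isIndependentOfSize (suc t)
    members : ∀ S → I⁺ S * suc t ≡ ∑[ v < n ] (⟦ lookup S v ⟧ * I⁺ S)
    members S = begin
      I⁺ S * suc t                       ≡⟨ size-indicator (suc t) S ⟨
      I⁺ S * size S                      ≡⟨ *-comm (I⁺ S) (size S) ⟩
      size S * I⁺ S                      ≡⟨ cong (_* I⁺ S) (size-∑ S) ⟩
      ∑[ v < n ] ⟦ lookup S v ⟧ * I⁺ S   ≡⟨ *-distribʳ-sum {n} (I⁺ S) (λ v → ⟦ lookup S v ⟧) ⟩
      ∑[ v < n ] (⟦ lookup S v ⟧ * I⁺ S) ∎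

closedDegree-regular : ∀ {n d} (G : Graph n) → Regular d G →
                       ∀ u → ∑[ v < n ] ⟦ closedAdj G u v ⟧ ≡ suc d
closedDegree-regular {n} G regular u = begin
  ∑[ v < n ] ⟦ closedAdj G u v ⟧                    ≡⟨ sum-cong-≗ {n} self-or-neighbour ⟩
  ∑[ v < n ] (⟦ ⌊ u ≟ v ⌋ ⟧ + ⟦ adj G u v ⟧)         ≡⟨ ∑-distrib-+ (λ v → ⟦ ⌊ u ≟ v ⌋ ⟧) (λ v → ⟦ adj G u v ⟧) ⟩
  ∑[ v < n ] ⟦ ⌊ u ≟ v ⌋ ⟧ + ∑[ v < n ] ⟦ adj G u v ⟧ ≡⟨ cong₂ _+_ (∑-δ u) (sym (count-tabulate (adj G u) id)) ⟩
  suc (degree G u)                                   ≡⟨ cong suc (regular u) ⟩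
  suc _ ∎
  where
  open ≡-Reasoning
  self-or-neighbour : ∀ v → ⟦ closedAdj G u v ⟧ ≡ ⟦ ⌊ u ≟ v ⌋ ⟧ + ⟦ adj G u v ⟧
  self-or-neighbour v with u ≟ v
  ... | yes refl rewrite irrefl G u = refl
  ... | no _ = refl

module _ {n} (G : Graph n) {k} (closedDegree : ∀ u → ∑[ v < n ] ⟦ closedAdj G u v ⟧ ≡ k) where

  ∑-coverCount : ∀ S → ∑[ v < n ] coverCount G S v ≡ size S * k
  ∑-coverCount S = begin
    ∑[ v < n ] ∑[ u < n ] ⟦ lookup S u ∧ closedAdj G u v ⟧
      ≡⟨ ∑-comm (λ u v → ⟦ lookup S u ∧ closedAdj G u v ⟧) ⟨
    ∑[ u < n ] ∑[ v < n ] ⟦ lookup S u ∧ closedAdj G u v ⟧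
      ≡⟨ sum-cong-≗ {n} closed-nbhd ⟩
    ∑[ u < n ] (⟦ lookup S u ⟧ * k)
      ≡⟨ *-distribʳ-sum {n} k (λ u → ⟦ lookup S u ⟧) ⟨
    ∑[ u < n ] ⟦ lookup S u ⟧ * k
      ≡⟨ cong (_* k) (size-∑ S) ⟨
    size S * k ∎
    where
    open ≡-Reasoning
    closed-nbhd : ∀ u → ∑[ v < n ] ⟦ lookup S u ∧ closedAdj G u v ⟧ ≡ ⟦ lookup S u ⟧ * k
    closed-nbhd u = begin
      ∑[ v < n ] ⟦ lookup S u ∧ closedAdj G u v ⟧
        ≡⟨ sum-cong-≗ {n} (λ v → ⟦∧⟧ (lookup S u) (closedAdj G u v)) ⟩
      ∑[ v < n ] (⟦ lookup S u ⟧ * ⟦ closedAdj G u v ⟧)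
        ≡⟨ *-distribˡ-sum {n} ⟦ lookup S u ⟧ (λ v → ⟦ closedAdj G u v ⟧) ⟨
      ⟦ lookup S u ⟧ * ∑[ v < n ] ⟦ closedAdj G u v ⟧
        ≡⟨ cong (⟦ lookup S u ⟧ *_) (closedDegree u) ⟩
      ⟦ lookup S u ⟧ * k ∎

  ∑-uncovered+coverCount : ∀ S →
    ∑[ v < n ] (⟦ coverCount G S v ≡ᵇ 0 ⟧ + coverCount G S v) ≡ size S * k + addable G S
  ∑-uncovered+coverCount S =
    trans (∑-distrib-+ (λ v → ⟦ coverCount G S v ≡ᵇ 0 ⟧) (coverCount G S))
          (trans (cong (addable G S +_) (∑-coverCount S)) (+-comm (addable G S) (size S * k)))

  addable-≥ : ∀ S → n ∸ size S * k ≤ addable G S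
  addable-≥ S = m≤n+o⇒m∸n≤o n (size S * k) (begin
    n                                                              ≡⟨ ∑-one n ⟨
    ∑[ v < n ] 1                                                   ≤⟨ ∑-mono-≤ (≡ᵇ0-indicator+≥1 ∘ coverCount G S) ⟩
    ∑[ v < n ] (⟦ coverCount G S v ≡ᵇ 0 ⟧ + coverCount G S v)      ≡⟨ ∑-uncovered+coverCount S ⟩
    size S * k + addable G S                                       ∎)
    where open ≤-Reasoning

  addable-≡ : ∀ S → (∀ v → coverCount G S v ≤ 1) → addable G S ≡ n ∸ size S * k
  addable-≡ S cover≤1 = trans (sym (m+n∸m≡n (size S * k) (addable G S))) (cong (_∸ size S * k) (begin
    size S * k + addable G S                                       ≡⟨ ∑-uncovered+coverCount S ⟨
    ∑[ v < n ] (⟦ coverCount G S v ≡ᵇ 0 ⟧ + coverCount G S v)      ≡⟨ sum-cong-≗ {n} (≡ᵇ0-indicator+≡1 ∘ cover≤1) ⟩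
    ∑[ v < n ] 1                                                   ≡⟨ ∑-one n ⟩
    n                                                              ∎))
    where open ≡-Reasoning

  indepCountOfSize-recurrence-≥ : ∀ t →
    indepCountOfSize G t * (n ∸ t * k) ≤ suc t * indepCountOfSize G (suc t)
  indepCountOfSize-recurrence-≥ t = begin
    indepCountOfSize G t * (n ∸ t * k)   ≡⟨ cong (_* (n ∸ t * k)) (indepCountOfSize-Σₛ G t) ⟩
    Σₛ I * (n ∸ t * k)                   ≡⟨ Σₛ-*ʳ (n ∸ t * k) I ⟨
    Σₛ (λ S → I S * (n ∸ t * k))         ≤⟨ Σₛ-mono-≤ (λ S → ⟦⟧*-mono-≤ (isIndependentOfSize G t S) (bound S)) ⟩
    Σₛ (λ S → I S * addable G S)         ≡⟨ doubleCount G t ⟨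
    suc t * indepCountOfSize G (suc t)   ∎
    where
    open ≤-Reasoning
    I : Vec Bool n → ℕ
    I = ⟦_⟧ ∘ isIndependentOfSize G t
    bound : ∀ S → isIndependentOfSize G t S ≡ true → n ∸ t * k ≤ addable G S
    bound S indep = subst (λ s → n ∸ s * k ≤ addable G S) (isIndependentOfSize⇒size≡ G S indep) (addable-≥ S)

  indepCountOfSize-recurrence-≡ : (∀ S → isIndependent G S ≡ true → ∀ v → coverCount G S v ≤ 1) → ∀ t →
    suc t * indepCountOfSize G (suc t) ≡ indepCountOfSize G t * (n ∸ t * k)
  indepCountOfSize-recurrence-≡ cover≤1 t = begin
    suc t * indepCountOfSize G (suc t)   ≡⟨ doubleCount G t ⟩
    Σₛ (λ S → I S * addable G S)         ≡⟨ Σₛ-cong (λ S → ⟦⟧*-cong (isIndependentOfSize G t S) (exact S)) ⟩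
    Σₛ (λ S → I S * (n ∸ t * k))         ≡⟨ Σₛ-*ʳ (n ∸ t * k) I ⟩
    Σₛ I * (n ∸ t * k)                   ≡⟨ cong (_* (n ∸ t * k)) (indepCountOfSize-Σₛ G t) ⟨
    indepCountOfSize G t * (n ∸ t * k)   ∎
    where
    open ≡-Reasoning
    I : Vec Bool n → ℕ
    I = ⟦_⟧ ∘ isIndependentOfSize G t
    exact : ∀ S → isIndependentOfSize G t S ≡ true → addable G S ≡ n ∸ t * k
    exact S indep = trans (addable-≡ S (cover≤1 S (isIndependentOfSize⇒isIndependent G S indep)))
                          (cong (λ s → n ∸ s * k) (isIndependentOfSize⇒size≡ G S indep))

-- Disjoint cliques

module _ (a d : ℕ) where

  block : Fin (a * suc d) → ℕ
  block u = toℕ u / suc d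

  closedAdj-cliques : ∀ u v → closedAdj (cliques a d) u v ≡ (block u ≡ᵇ block v)
  closedAdj-cliques u v with u ≟ v
  ... | yes refl = sym (≡ᵇ-refl (block u))
  ... | no _ = refl

  adj-cliques : ∀ u w → u ≢ w → block u ≡ block w → adj (cliques a d) u w ≡ true
  adj-cliques u w u≢w same with u ≟ w
  ... | yes u≡w = contradiction u≡w u≢w
  ... | no _ rewrite same = ≡ᵇ-refl (block w)

  blockSize : ∀ b k → k < b → ∑[ i < b * suc d ] ⟦ k ≡ᵇ toℕ i / suc d ⟧ ≡ suc d
  blockSize (suc b) k k<1+b =
    trans (∑-+-split (suc d) (b * suc d) (λ i → ⟦ k ≡ᵇ i / suc d ⟧)) (first+rest k k<1+b)
    where
    first : ∀ (i : Fin (suc d)) → toℕ i / suc d ≡ 0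
    first i = m<n⇒m/n≡0 (toℕ<n i)
    rest : ∀ i → (suc d + i) / suc d ≡ suc (i / suc d)
    rest i = trans (m/n≡1+[m∸n]/n (m≤m+n (suc d) i)) (cong (λ j → suc (j / suc d)) (m+n∸m≡n (suc d) i))
    first+rest : ∀ k → k < suc b →
      ∑[ i < suc d ] ⟦ k ≡ᵇ toℕ i / suc d ⟧ + ∑[ i < b * suc d ] ⟦ k ≡ᵇ (suc d + toℕ i) / suc d ⟧ ≡ suc d
    first+rest zero _ = begin
      ∑[ i < suc d ] ⟦ 0 ≡ᵇ toℕ i / suc d ⟧ + ∑[ i < b * suc d ] ⟦ 0 ≡ᵇ (suc d + toℕ i) / suc d ⟧
        ≡⟨ cong₂ _+_ (sum-cong-≗ {suc d} (cong (⟦_⟧ ∘ (0 ≡ᵇ_)) ∘ first))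
                     (sum-cong-≗ {b * suc d} (cong (⟦_⟧ ∘ (0 ≡ᵇ_)) ∘ rest ∘ toℕ)) ⟩
      ∑[ i < suc d ] 1 + ∑[ i < b * suc d ] 0
        ≡⟨ cong₂ _+_ (∑-one (suc d)) (∑-zero (b * suc d)) ⟩
      suc d + 0
        ≡⟨ +-identityʳ (suc d) ⟩
      suc d ∎
      where open ≡-Reasoning
    first+rest (suc k) (s≤s k<b) = begin
      ∑[ i < suc d ] ⟦ suc k ≡ᵇ toℕ i / suc d ⟧ + ∑[ i < b * suc d ] ⟦ suc k ≡ᵇ (suc d + toℕ i) / suc d ⟧
        ≡⟨ cong₂ _+_ (sum-cong-≗ {suc d} (cong (⟦_⟧ ∘ (suc k ≡ᵇ_)) ∘ first))
                     (sum-cong-≗ {b * suc d} (cong (⟦_⟧ ∘ (suc k ≡ᵇ_)) ∘ rest ∘ toℕ)) ⟩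
      ∑[ i < suc d ] 0 + ∑[ i < b * suc d ] ⟦ k ≡ᵇ toℕ i / suc d ⟧
        ≡⟨ cong₂ _+_ (∑-zero (suc d)) (blockSize b k k<b) ⟩
      suc d ∎
      where open ≡-Reasoning

  closedDegree-cliques : ∀ u → ∑[ v < a * suc d ] ⟦ closedAdj (cliques a d) u v ⟧ ≡ suc d
  closedDegree-cliques u =
    trans (sum-cong-≗ {a * suc d} (cong ⟦_⟧ ∘ closedAdj-cliques u))
          (blockSize a (block u) (m<n*o⇒m/o<n (toℕ<n u)))

  coverCount-cliques-≤1 : ∀ S → isIndependent (cliques a d) S ≡ true →
                          ∀ v → coverCount (cliques a d) S v ≤ 1
  coverCount-cliques-≤1 S indep v = ∑-⟦⟧-≤1 (λ u → lookup S u ∧ closedAdj (cliques a d) u v) same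
    where
    same-block : ∀ u → lookup S u ∧ closedAdj (cliques a d) u v ≡ true → block u ≡ block v
    same-block u covers = ≡ᵇ-true⇒≡ (trans (sym (closedAdj-cliques u v)) (∧-conicalʳ _ _ covers))
    same : ∀ u w → lookup S u ∧ closedAdj (cliques a d) u v ≡ true →
                   lookup S w ∧ closedAdj (cliques a d) w v ≡ true → u ≡ w
    same u w u-covers w-covers with u ≟ w
    ... | yes u≡w = u≡w
    ... | no u≢w = contradiction (trans (sym adjacent) non-adjacent) λ ()
      where
      adjacent : adj (cliques a d) u w ≡ true
      adjacent = adj-cliques u w u≢w (trans (same-block u u-covers) (sym (same-block w w-covers)))
      non-adjacent : adj (cliques a d) u w ≡ false
      non-adjacent = isIndependent⁻ (cliques a d) S indep u w (∧-conicalˡ _ _ u-covers) (∧-conicalˡ _ _ w-covers)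

-- Binomial coefficients and the recurrence

[k+1]*nC[k+1]≡[n∸k]*nCk : ∀ n k → suc k * (n C suc k) ≡ (n ∸ k) * (n C k)
[k+1]*nC[k+1]≡[n∸k]*nCk zero k =
  trans (cong (suc k *_) (k>n⇒nCk≡0 {0} {suc k} (s≤s z≤n)))
        (trans (*-zeroʳ (suc k)) (cong (_* (0 C k)) (sym (0∸n≡0 k))))
[k+1]*nC[k+1]≡[n∸k]*nCk (suc n) zero = trans (+-identityʳ _) (trans (nC1≡n (suc n)) (sym (*-identityʳ (suc n))))
[k+1]*nC[k+1]≡[n∸k]*nCk (suc n) (suc k) = begin
  suc (suc k) * (suc n C suc (suc k))
    ≡⟨ cong (suc (suc k) *_) (nCk+nC[k+1]≡[n+1]C[k+1] n (suc k)) ⟨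
  suc (suc k) * (n C suc k + n C suc (suc k))
    ≡⟨ *-distribˡ-+ (suc (suc k)) (n C suc k) (n C suc (suc k)) ⟩
  suc (suc k) * (n C suc k) + suc (suc k) * (n C suc (suc k))
    ≡⟨ cong (suc (suc k) * (n C suc k) +_) ([k+1]*nC[k+1]≡[n∸k]*nCk n (suc k)) ⟩
  suc (suc k) * (n C suc k) + (n ∸ suc k) * (n C suc k)
    ≡⟨ *-distribʳ-+ (n C suc k) (suc (suc k)) (n ∸ suc k) ⟨
  (suc (suc k) + (n ∸ suc k)) * (n C suc k)
    ≡⟨ coefficients ⟩
  (suc k + (n ∸ k)) * (n C suc k)
    ≡⟨ *-distribʳ-+ (n C suc k) (suc k) (n ∸ k) ⟩
  suc k * (n C suc k) + (n ∸ k) * (n C suc k)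
    ≡⟨ cong (_+ (n ∸ k) * (n C suc k)) ([k+1]*nC[k+1]≡[n∸k]*nCk n k) ⟩
  (n ∸ k) * (n C k) + (n ∸ k) * (n C suc k)
    ≡⟨ *-distribˡ-+ (n ∸ k) (n C k) (n C suc k) ⟨
  (n ∸ k) * (n C k + n C suc k)
    ≡⟨ cong ((n ∸ k) *_) (nCk+nC[k+1]≡[n+1]C[k+1] n k) ⟩
  (n ∸ k) * (suc n C suc k) ∎
  where
  open ≡-Reasoning
  -- The two coefficients differ only when n ≤ k, and then n C (k + 1) vanishes.
  coefficients : (suc (suc k) + (n ∸ suc k)) * (n C suc k) ≡ (suc k + (n ∸ k)) * (n C suc k)
  coefficients with k <? n
  ... | yes k<n = cong (_* (n C suc k))
                       (trans (sym (+-suc (suc k) (n ∸ suc k))) (cong (suc k +_) (sym (+-∸-assoc 1 k<n))))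
  ... | no k≮n rewrite k>n⇒nCk≡0 (s≤s (≮⇒≥ k≮n)) =
        trans (*-zeroʳ (suc (suc k) + (n ∸ suc k))) (sym (*-zeroʳ (suc k + (n ∸ k))))

∑-binomial : ∀ x a m → a < m → ∑[ t < m ] (x ^ toℕ t * (a C toℕ t)) ≡ suc x ^ a
∑-binomial x zero (suc m) _ = cong suc (trans (sum-cong-≗ {m} vanish) (∑-zero m))
  where
  vanish : ∀ t → x ^ suc (toℕ t) * (0 C suc (toℕ t)) ≡ 0
  vanish t = *-zeroʳ (x ^ suc (toℕ t))
∑-binomial x (suc a) (suc m) (s≤s a<m) = begin
  1 + ∑[ t < m ] (x ^ suc (toℕ t) * (suc a C suc (toℕ t)))
    ≡⟨ cong suc (sum-cong-≗ {m} pascal) ⟩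
  1 + ∑[ t < m ] (x * (x ^ toℕ t * (a C toℕ t)) + x ^ suc (toℕ t) * (a C suc (toℕ t)))
    ≡⟨ cong suc (∑-distrib-+ {m} (λ t → x * (x ^ toℕ t * (a C toℕ t))) (λ t → x ^ suc (toℕ t) * (a C suc (toℕ t)))) ⟩
  1 + (∑[ t < m ] (x * (x ^ toℕ t * (a C toℕ t))) + ∑[ t < m ] (x ^ suc (toℕ t) * (a C suc (toℕ t))))
    ≡⟨ cong (λ s → 1 + (s + ∑[ t < m ] (x ^ suc (toℕ t) * (a C suc (toℕ t)))))
            (trans (sym (*-distribˡ-sum {m} x (λ t → x ^ toℕ t * (a C toℕ t)))) (cong (x *_) (∑-binomial x a m a<m))) ⟩
  1 + (x * suc x ^ a + ∑[ t < m ] (x ^ suc (toℕ t) * (a C suc (toℕ t))))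
    ≡⟨ cong suc (+-comm (x * suc x ^ a) _) ⟩
  ∑[ t < suc m ] (x ^ toℕ t * (a C toℕ t)) + x * suc x ^ a
    ≡⟨ cong (_+ x * suc x ^ a) (∑-binomial x a (suc m) (m<n⇒m<1+n a<m)) ⟩
  suc x ^ a + x * suc x ^ a ∎
  where
  open ≡-Reasoning
  pascal : ∀ t → x ^ suc (toℕ t) * (suc a C suc (toℕ t))
                 ≡ x * (x ^ toℕ t * (a C toℕ t)) + x ^ suc (toℕ t) * (a C suc (toℕ t))
  pascal t = begin
    x ^ suc (toℕ t) * (suc a C suc (toℕ t))
      ≡⟨ cong (x ^ suc (toℕ t) *_) (nCk+nC[k+1]≡[n+1]C[k+1] a (toℕ t)) ⟨
    x ^ suc (toℕ t) * (a C toℕ t + a C suc (toℕ t))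
      ≡⟨ *-distribˡ-+ (x ^ suc (toℕ t)) (a C toℕ t) (a C suc (toℕ t)) ⟩
    x ^ suc (toℕ t) * (a C toℕ t) + x ^ suc (toℕ t) * (a C suc (toℕ t))
      ≡⟨ cong (_+ x ^ suc (toℕ t) * (a C suc (toℕ t))) (*-assoc x (x ^ toℕ t) (a C toℕ t)) ⟩
    x * (x ^ toℕ t * (a C toℕ t)) + x ^ suc (toℕ t) * (a C suc (toℕ t)) ∎

x^k*aCk-recurrence : ∀ x a t → suc t * (x ^ suc t * (a C suc t)) ≡ x ^ t * (a C t) * (a * x ∸ t * x)
x^k*aCk-recurrence x a t = begin
  suc t * (x ^ suc t * (a C suc t))
    ≡⟨ solve 4 (λ T X P B → T :* ((X :* P) :* B) := (X :* P) :* (T :* B)) refl (suc t) x (x ^ t) (a C suc t) ⟩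
  x * x ^ t * (suc t * (a C suc t))
    ≡⟨ cong (x * x ^ t *_) ([k+1]*nC[k+1]≡[n∸k]*nCk a t) ⟩
  x * x ^ t * ((a ∸ t) * (a C t))
    ≡⟨ solve 4 (λ X P D A → (X :* P) :* (D :* A) := (P :* A) :* (D :* X)) refl x (x ^ t) (a ∸ t) (a C t) ⟩
  x ^ t * (a C t) * ((a ∸ t) * x)
    ≡⟨ cong (x ^ t * (a C t) *_) (*-distribʳ-∸ x a t) ⟩
  x ^ t * (a C t) * (a * x ∸ t * x) ∎
  where
  open ≡-Reasoning
  open +-*-Solver

recurrence-≤ : ∀ {f g r : ℕ → ℕ} → f 0 ≤ g 0 →
  (∀ t → suc t * f (suc t) ≡ f t * r t) → (∀ t → g t * r t ≤ suc t * g (suc t)) → ∀ t → f t ≤ g t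
recurrence-≤ f₀≤g₀ f-rec g-rec zero = f₀≤g₀
recurrence-≤ {f} {g} {r} f₀≤g₀ f-rec g-rec (suc t) = *-cancelˡ-≤ (suc t) (begin
  suc t * f (suc t)   ≡⟨ f-rec t ⟩
  f t * r t           ≤⟨ *-monoˡ-≤ (r t) (recurrence-≤ {f} {g} {r} f₀≤g₀ f-rec g-rec t) ⟩
  g t * r t           ≤⟨ g-rec t ⟩
  suc t * g (suc t)   ∎)
  where open ≤-Reasoning

recurrence-unique : ∀ {f g r : ℕ → ℕ} → f 0 ≡ g 0 →
  (∀ t → suc t * f (suc t) ≡ f t * r t) → (∀ t → suc t * g (suc t) ≡ g t * r t) → ∀ t → f t ≡ g t
recurrence-unique f₀≡g₀ f-rec g-rec zero = f₀≡g₀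
recurrence-unique {f} {g} {r} f₀≡g₀ f-rec g-rec (suc t) = *-cancelˡ-≡ (f (suc t)) (g (suc t)) (suc t) (begin
  suc t * f (suc t)   ≡⟨ f-rec t ⟩
  f t * r t           ≡⟨ cong (_* r t) (recurrence-unique {f} {g} {r} f₀≡g₀ f-rec g-rec t) ⟩
  g t * r t           ≡⟨ g-rec t ⟨
  suc t * g (suc t)   ∎)
  where open ≡-Reasoning

theorem2p1 : (d a : ℕ) → 1 ≤ a → (G : Graph (a * suc d)) → Regular d G →
    (indepCount G ≥ indepCount (cliques a d)
      × indepCount (cliques a d) ≡ suc (suc d) ^ a)
    × (∀ t → t ≤ a * suc d →
        indepCountOfSize G t ≥ indepCountOfSize (cliques a d) t
        × indepCountOfSize (cliques a d) t ≡ suc d ^ t * (a C t))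
theorem2p1 d a _ G regular = (total-≥ , total-≡) , λ t _ → sized-≥ t , sized-≡ t
  where
  n : ℕ
  n = a * suc d
  K : Graph n
  K = cliques a d
  F : ℕ → ℕ
  F t = suc d ^ t * (a C t)

  F-recurrence : ∀ t → suc t * F (suc t) ≡ F t * (n ∸ t * suc d)
  F-recurrence = x^k*aCk-recurrence (suc d) a

  sized-≡ : ∀ t → indepCountOfSize K t ≡ F t
  sized-≡ = recurrence-unique {indepCountOfSize K} {F} (indepCountOfSize-zero K)
    (indepCountOfSize-recurrence-≡ K (closedDegree-cliques a d) (coverCount-cliques-≤1 a d)) F-recurrence

  sized-≥ : ∀ t → indepCountOfSize K t ≤ indepCountOfSize G t
  sized-≥ t = subst (_≤ indepCountOfSize G t) (sym (sized-≡ t))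
    (recurrence-≤ {F} {indepCountOfSize G} (≤-reflexive (sym (indepCountOfSize-zero G))) F-recurrence
      (indepCountOfSize-recurrence-≥ G (closedDegree-regular G regular)) t)

  total-≡ : indepCount K ≡ suc (suc d) ^ a
  total-≡ = trans (indepCount-∑ K)
    (trans (sum-cong-≗ {suc n} (sized-≡ ∘ toℕ)) (∑-binomial (suc d) a (suc n) (s≤s (m≤m*n a (suc d)))))

  total-≥ : indepCount K ≤ indepCount G
  total-≥ = subst₂ _≤_ (sym (indepCount-∑ K)) (sym (indepCount-∑ G)) (∑-mono-≤ {suc n} (sized-≥ ∘ toℕ))
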